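{- For every finite subgraph $F\subseteq T_\infty$, $\Delta_\theta(F)\ge\partial(F)/3$.
   Context: $T_\infty$ is the infinite tree whose vertex set is partitioned into levels $V_0,V_1,\dots$ such that each vertex of $V_j$ has exactly one neighbor in $V_{j+1}$ (its parent), each vertex of $V_j$ with $j\ge1$ has exactly two neighbors in $V_{j-1}$ (its children), there are no other edges, and any two vertices have a common ancestor; $V_0$ is the set of leaves. Subgraphs have no isolated vertices. $\partial(F)$ is the number of vertices of $F$ that are incident to at least one edge of $T_\infty$ not in $E(F)$. $\theta(e)=4/3$ if $e$ contains a vertex of $V_0$ and $\theta(e)=2/3$ otherwise (the weighting induced by the uniform random walk), and $\Delta_\theta(F)=|V(F)|-\sum_{e\in E(F)}\theta(e)$. -}

module Defs where

open import Data.Nat as ℕ using (ℕ; zero; suc; _*_; _+_; _/_)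
open import Data.Nat.Properties using () renaming (_≟_ to _≟ℕ_)
open import Data.Product using (_×_; _,_; proj₁; proj₂)
open import Data.Product.Properties using (≡-dec)
open import Data.List using (List; []; _∷_; length; filter; deduplicate; concatMap; map; foldr)
open import Data.List.Relation.Unary.Any using (Any; any?)
open import Data.List.Membership.DecPropositional using ()
import Data.List.Membership.DecPropositional as DecMem
open import Data.Integer using (+_)
open import Data.Rational as ℚ using (ℚ; 0ℚ)
open import Relation.Nullary using (¬_; ¬?)
open import Relation.Binary.PropositionalEquality using (_≡_)
open import Relation.Binary.Definitions using (DecidableEquality)

-- Concrete model of T_∞ (the canopy tree).
-- A vertex is a pair (j , n): level j, index n.  V_j = { (j , n) | n : ℕ }.
-- The parent of (j , n) is (j+1 , ⌊n/2⌋); hence (j+1 , n) has exactly the two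
-- children (j , 2n) and (j , 2n+1), and any two vertices have a common
-- ancestor (at a high level every index becomes 0).
Vertex : Set
Vertex = ℕ × ℕ

level : Vertex → ℕ
level = proj₁

_≟v_ : DecidableEquality Vertex
_≟v_ = ≡-dec _≟ℕ_ _≟ℕ_

parent : Vertex → Vertex
parent (j , n) = (suc j , n / 2)

-- Every edge of T_∞ joins a vertex to its parent; we name an edge by its
-- lower endpoint (the child).  This is a bijection Vertex ≃ E(T_∞).
Edge : Set
Edge = Vertex

endpoints : Edge → List Vertex
endpoints e = e ∷ parent e ∷ []

children : Vertex → List Vertex
children (zero , n) = []
children (suc j , n) = (j , 2 * n) ∷ (j , 2 * n + 1) ∷ []

incidentEdges : Vertex → List Edge
incidentEdges v = v ∷ children v

-- A finite subgraph (without isolated vertices) is given by a finite set of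
-- edges, presented as a list (repetitions are harmless: we deduplicate).
Subgraph : Set
Subgraph = List Edge

open DecMem _≟v_ using (_∈?_; _∈_)

E : Subgraph → List Edge
E F = deduplicate _≟v_ F

V : Subgraph → List Vertex
V F = deduplicate _≟v_ (concatMap endpoints F)

-- θ(e) = 4/3 if e contains a leaf (i.e. its child endpoint is in V_0), else 2/3
θ : Edge → ℚ
θ (zero , _) = + 4 ℚ./ 3
θ (suc _ , _) = + 2 ℚ./ 3

sumℚ : List ℚ → ℚ
sumℚ = foldr ℚ._+_ 0ℚ

Δθ : Subgraph → ℚ
Δθ F = (+ length (V F) ℚ./ 1) ℚ.- sumℚ (map θ (E F))

∂ : Subgraph → ℕ
∂ F = length (filter (λ v → any? (λ e → ¬? (e ∈? F)) (incidentEdges v)) (V F))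

-- Multiply by 3: with weight e = 3θ(e) (4 on leaf edges, 2 otherwise) the claim becomes
-- ∂(F) + Σ_{e∈E(F)} weight e ≤ 3|V(F)|.  Discharge the weights onto vertices: an edge e
-- sends 1 to its upper endpoint and the rest (3 for a leaf edge, 1 otherwise) to its lower
-- endpoint.  A leaf of F lies on its own edge, so it receives 3 and is not a boundary vertex.
-- An inner vertex receives 1 per incident edge of F, and it is a boundary vertex only if one
-- of its three incident edges is missing; either way boundary plus received charge is ≤ 3.
module Submission where

open import Defs
open import Data.Integer using (+_)
open import Data.Rational using (_≤_; _/_)

open import Data.Bool using (if_then_else_)
open import Data.Empty using (⊥-elim)
open import Data.Integer as ℤ using (+≤+)
import Data.Integer.Properties as ℤ
open import Data.Integer.Tactic.RingSolver using (solve-∀)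
open import Data.List using (List; []; _∷_; length; filter; map; deduplicate; concatMap)
open import Data.List.Membership.Propositional using (_∈_; _∉_)
open import Data.List.Membership.Propositional.Properties
  using (∈-deduplicate⁺; ∈-deduplicate⁻; ∈-concatMap⁺; ∈-concatMap⁻)
open import Data.List.Relation.Unary.All as All using ([]; _∷_)
open import Data.List.Relation.Unary.All.Properties using (All¬⇒¬Any; Any¬⇒¬All)
open import Data.List.Relation.Unary.Any as Any using (here; there; any?)
open import Data.List.Relation.Unary.AllPairs using (_∷_)
open import Data.List.Relation.Unary.Unique.Propositional using (Unique)
open import Data.Nat.Base as ℕ using (ℕ; zero; suc; z≤n; s≤s) hiding (module ℕ)
import Data.Nat.Properties as ℕ
open import Algebra.Properties.CommutativeSemigroup ℕ.+-commutativeSemigroup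
  using () renaming (interchange to +-interchange)
open import Data.Nat.DivMod using (m≡m%n+[m/n]*n; m%n<n)
open import Data.Nat.ListAction using (sum)
open import Data.Product using (_,_)
open import Data.Sum using (_⊎_; inj₁; inj₂)
import Data.Rational as ℚ
open import Data.Rational.Properties using (toℚᵘ-cancel-≤; toℚᵘ-fromℚᵘ; toℚᵘ-homo-+; toℚᵘ-homo‿-)
open import Data.Rational.Unnormalised as ℚᵘ using (ℚᵘ; mkℚᵘ; _≃_; *≡*; *≤*)
import Data.Rational.Unnormalised.Properties as ℚᵘ
open import Relation.Binary.Definitions using (DecidableEquality)
open import Relation.Unary using (Decidable)
open import Relation.Binary.PropositionalEquality
open import Relation.Nullary using (Dec; yes; no; does; ¬_; ¬?)

module _ {A : Set} where

  ∑ : List A → (A → ℕ) → ℕ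
  ∑ xs f = sum (map f xs)

  ∑-cong : ∀ xs {f g : A → ℕ} → (∀ {x} → x ∈ xs → f x ≡ g x) → ∑ xs f ≡ ∑ xs g
  ∑-cong []       f≡g = refl
  ∑-cong (x ∷ xs) f≡g = cong₂ ℕ._+_ (f≡g (here refl)) (∑-cong xs (λ x∈xs → f≡g (there x∈xs)))

  ∑-mono-≤ : ∀ xs {f g : A → ℕ} → (∀ {x} → x ∈ xs → f x ℕ.≤ g x) → ∑ xs f ℕ.≤ ∑ xs g
  ∑-mono-≤ []       f≤g = z≤n
  ∑-mono-≤ (x ∷ xs) f≤g = ℕ.+-mono-≤ (f≤g (here refl)) (∑-mono-≤ xs (λ x∈xs → f≤g (there x∈xs)))

  ∑-distrib-+ : ∀ xs (f g : A → ℕ) → ∑ xs (λ x → f x ℕ.+ g x) ≡ ∑ xs f ℕ.+ ∑ xs g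
  ∑-distrib-+ []       f g = refl
  ∑-distrib-+ (x ∷ xs) f g = begin
    f x ℕ.+ g x ℕ.+ ∑ xs (λ x → f x ℕ.+ g x)  ≡⟨ cong (f x ℕ.+ g x ℕ.+_) (∑-distrib-+ xs f g) ⟩
    f x ℕ.+ g x ℕ.+ (∑ xs f ℕ.+ ∑ xs g)        ≡⟨ +-interchange (f x) (g x) (∑ xs f) (∑ xs g) ⟩
    f x ℕ.+ ∑ xs f ℕ.+ (g x ℕ.+ ∑ xs g)        ∎
    where open ≡-Reasoning

  ∑-distribˡ-* : ∀ xs k (f : A → ℕ) → ∑ xs (λ x → k ℕ.* f x) ≡ k ℕ.* ∑ xs f
  ∑-distribˡ-* []       k f = sym (ℕ.*-zeroʳ k)
  ∑-distribˡ-* (x ∷ xs) k f =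
    trans (cong (k ℕ.* f x ℕ.+_) (∑-distribˡ-* xs k f)) (sym (ℕ.*-distribˡ-+ k (f x) (∑ xs f)))

  ∑-const : ∀ xs k → ∑ xs (λ _ → k) ≡ k ℕ.* length xs
  ∑-const []       k = sym (ℕ.*-zeroʳ k)
  ∑-const (x ∷ xs) k = trans (cong (k ℕ.+_) (∑-const xs k)) (sym (ℕ.*-suc k (length xs)))

∑-comm : ∀ {A B : Set} xs ys (f : A → B → ℕ) →
         ∑ xs (λ x → ∑ ys (f x)) ≡ ∑ ys (λ y → ∑ xs (λ x → f x y))
∑-comm []       ys f = sym (∑-const ys 0)
∑-comm (x ∷ xs) ys f =
  trans (cong (∑ ys (f x) ℕ.+_) (∑-comm xs ys f)) (sym (∑-distrib-+ ys (f x) _))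

𝟙 : {P : Set} → Dec P → ℕ
𝟙 d = if does d then 1 else 0

𝟙-yes : {P : Set} (d : Dec P) → P → 𝟙 d ≡ 1
𝟙-yes (yes _) _ = refl
𝟙-yes (no ¬p) p = ⊥-elim (¬p p)

𝟙-no : {P : Set} (d : Dec P) → ¬ P → 𝟙 d ≡ 0
𝟙-no (yes p) ¬p = ⊥-elim (¬p p)
𝟙-no (no _)  _  = refl

module _ {A : Set} {P : A → Set} (P? : Decidable P) where

  length-filter≡∑𝟙 : ∀ xs → length (filter P? xs) ≡ ∑ xs (λ x → 𝟙 (P? x))
  length-filter≡∑𝟙 []       = refl
  length-filter≡∑𝟙 (x ∷ xs) with P? x
  ... | yes _ = cong suc (length-filter≡∑𝟙 xs)
  ... | no  _ = length-filter≡∑𝟙 xs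

  𝟙-any¬+∑𝟙≤length : ∀ xs → 𝟙 (any? (λ x → ¬? (P? x)) xs) ℕ.+ ∑ xs (λ x → 𝟙 (P? x)) ℕ.≤ length xs
  𝟙-any¬+∑𝟙≤length []       = z≤n
  𝟙-any¬+∑𝟙≤length (x ∷ xs) with P? x
  ... | yes _ = ℕ.≤-trans (ℕ.≤-reflexive (ℕ.+-suc _ _)) (s≤s (𝟙-any¬+∑𝟙≤length xs))
  ... | no  _ = s≤s (ℕ.m+n≤o⇒n≤o _ (𝟙-any¬+∑𝟙≤length xs))

module Counting {A : Set} (_≟_ : DecidableEquality A) where

  open import Data.List.Membership.DecPropositional _≟_ using (_∈?_)
  open import Data.List.Relation.Unary.Unique.DecPropositional.Properties _≟_ using (deduplicate-!)

  count : A → List A → ℕ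
  count x xs = ∑ xs (λ y → 𝟙 (x ≟ y))

  𝟙-≟-sym : ∀ x y → 𝟙 (x ≟ y) ≡ 𝟙 (y ≟ x)
  𝟙-≟-sym x y with x ≟ y
  ... | yes refl = sym (𝟙-yes (x ≟ x) refl)
  ... | no x≢y   = sym (𝟙-no (y ≟ x) (λ y≡x → x≢y (sym y≡x)))

  *-𝟙-≟-swap : ∀ (f : A → ℕ) x y → f x ℕ.* 𝟙 (x ≟ y) ≡ f y ℕ.* 𝟙 (y ≟ x)
  *-𝟙-≟-swap f x y with x ≟ y
  ... | yes refl = cong (f x ℕ.*_) (sym (𝟙-yes (x ≟ x) refl))
  ... | no x≢y   = trans (ℕ.*-zeroʳ (f x)) (sym (trans
                     (cong (f y ℕ.*_) (𝟙-no (y ≟ x) (λ y≡x → x≢y (sym y≡x)))) (ℕ.*-zeroʳ (f y))))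

  count-∉ : ∀ {x} xs → x ∉ xs → count x xs ≡ 0
  count-∉ []       x∉xs = refl
  count-∉ {x} (y ∷ xs) x∉xs =
    cong₂ ℕ._+_ (𝟙-no (x ≟ y) (λ x≡y → x∉xs (here x≡y))) (count-∉ xs (λ x∈xs → x∉xs (there x∈xs)))

  count-∈ : ∀ {x xs} → x ∈ xs → 1 ℕ.≤ count x xs
  count-∈ {x} {y ∷ xs} (here refl) = ℕ.≤-trans (ℕ.≤-reflexive (sym (𝟙-yes (x ≟ x) refl))) (ℕ.m≤m+n _ _)
  count-∈ {x} {y ∷ xs} (there x∈xs) = ℕ.≤-trans (count-∈ x∈xs) (ℕ.m≤n+m _ _)

  count-unique-∈ : ∀ {x xs} → Unique xs → x ∈ xs → count x xs ≡ 1
  count-unique-∈ {x} (y∉xs ∷ _) (here refl) =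
    cong₂ ℕ._+_ (𝟙-yes (x ≟ x) refl) (count-∉ _ (All¬⇒¬Any y∉xs))
  count-unique-∈ {x} {y ∷ _} (y∉xs ∷ unique) (there x∈xs) =
    cong₂ ℕ._+_ (𝟙-no (x ≟ y) (λ { refl → All.lookup y∉xs x∈xs refl })) (count-unique-∈ unique x∈xs)

  count-deduplicate : ∀ x xs → count x (deduplicate _≟_ xs) ≡ 𝟙 (x ∈? xs)
  count-deduplicate x xs with x ∈? xs
  ... | yes x∈xs = count-unique-∈ (deduplicate-! xs) (∈-deduplicate⁺ _≟_ x∈xs)
  ... | no  x∉xs = count-∉ _ (λ x∈ded → x∉xs (∈-deduplicate⁻ _≟_ xs x∈ded))

open Counting _≟v_
open import Data.List.Membership.DecPropositional _≟v_ using (_∈?_)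
open import Data.List.Relation.Unary.Unique.DecPropositional.Properties _≟v_ using (deduplicate-!)

lowerShare : Edge → ℕ
lowerShare (zero  , _) = 3
lowerShare (suc _ , _) = 1

weight : Edge → ℕ
weight e = lowerShare e ℕ.+ 1

share : Edge → Vertex → ℕ
share e v = lowerShare e ℕ.* 𝟙 (e ≟v v) ℕ.+ 𝟙 (parent e ≟v v)

received : Subgraph → Vertex → ℕ
received F v = lowerShare v ℕ.* 𝟙 (v ∈? F) ℕ.+ ∑ (children v) (λ c → 𝟙 (c ∈? F))

boundary : Subgraph → Vertex → ℕ
boundary F v = 𝟙 (any? (λ e → ¬? (e ∈? F)) (incidentEdges v))

even-or-odd : ∀ m → m ≡ 2 ℕ.* (m ℕ./ 2) ⊎ m ≡ 2 ℕ.* (m ℕ./ 2) ℕ.+ 1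
even-or-odd m with m ℕ.% 2 | m≡m%n+[m/n]*n m 2 | m%n<n m 2
... | 0 | m≡ | _ = inj₁ (trans m≡ (ℕ.*-comm (m ℕ./ 2) 2))
... | 1 | m≡ | _ = inj₂ (trans m≡ (trans (ℕ.+-comm 1 _) (cong (ℕ._+ 1) (ℕ.*-comm (m ℕ./ 2) 2))))
... | suc (suc _) | _ | s≤s (s≤s ())

∈-children-parent : ∀ e → e ∈ children (parent e)
∈-children-parent (j , m) with even-or-odd m
... | inj₁ even = here (cong (j ,_) even)
... | inj₂ odd  = there (here (cong (j ,_) odd))

endpoint∈V : ∀ {F e x} → e ∈ F → x ∈ endpoints e → x ∈ V F
endpoint∈V e∈F x∈e = ∈-deduplicate⁺ _≟v_ (∈-concatMap⁺ endpoints (Any.map (λ { refl → x∈e }) e∈F))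

-- A leaf is never a parent.
leaf∈V⇒∈F : ∀ {F n} → (zero , n) ∈ V F → (zero , n) ∈ F
leaf∈V⇒∈F {F} {n} leaf∈V =
  Any.map lowerEndpoint (∈-concatMap⁻ endpoints (∈-deduplicate⁻ _≟v_ (concatMap endpoints F) leaf∈V))
  where
  lowerEndpoint : ∀ {e} → (zero , n) ∈ endpoints e → (zero , n) ≡ e
  lowerEndpoint (here leaf≡e) = leaf≡e
  lowerEndpoint (there (here ()))

∑-share≡weight : ∀ F {e} → e ∈ F → ∑ (V F) (share e) ≡ weight e
∑-share≡weight F {e} e∈F = begin
  ∑ (V F) (share e)
    ≡⟨ ∑-distrib-+ (V F) (λ v → lowerShare e ℕ.* 𝟙 (e ≟v v)) (λ v → 𝟙 (parent e ≟v v)) ⟩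
  ∑ (V F) (λ v → lowerShare e ℕ.* 𝟙 (e ≟v v)) ℕ.+ count (parent e) (V F)
    ≡⟨ cong (ℕ._+ count (parent e) (V F)) (∑-distribˡ-* (V F) (lowerShare e) (λ v → 𝟙 (e ≟v v))) ⟩
  lowerShare e ℕ.* count e (V F) ℕ.+ count (parent e) (V F)
    ≡⟨ cong₂ (λ m n → lowerShare e ℕ.* m ℕ.+ n) (count-unique-∈ unique (endpoint∈V e∈F (here refl)))
                                                (count-unique-∈ unique (endpoint∈V e∈F (there (here refl)))) ⟩
  lowerShare e ℕ.* 1 ℕ.+ 1
    ≡⟨ cong (ℕ._+ 1) (ℕ.*-identityʳ (lowerShare e)) ⟩
  weight e ∎
  where
  open ≡-Reasoning
  unique = deduplicate-! (concatMap endpoints F)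

𝟙-parent-≟≤count-children : ∀ e v → 𝟙 (parent e ≟v v) ℕ.≤ count e (children v)
𝟙-parent-≟≤count-children e v with parent e ≟v v
... | yes refl = count-∈ (∈-children-parent e)
... | no  _    = z≤n

∑-share≤received : ∀ F v → ∑ (E F) (λ e → share e v) ℕ.≤ received F v
∑-share≤received F v = begin
  ∑ (E F) (λ e → share e v)
    ≡⟨ ∑-distrib-+ (E F) (λ e → lowerShare e ℕ.* 𝟙 (e ≟v v)) (λ e → 𝟙 (parent e ≟v v)) ⟩
  ∑ (E F) (λ e → lowerShare e ℕ.* 𝟙 (e ≟v v)) ℕ.+ ∑ (E F) (λ e → 𝟙 (parent e ≟v v))
    ≡⟨ cong (ℕ._+ ∑ (E F) (λ e → 𝟙 (parent e ≟v v))) fromOwnEdge ⟩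
  lowerShare v ℕ.* 𝟙 (v ∈? F) ℕ.+ ∑ (E F) (λ e → 𝟙 (parent e ≟v v))
    ≤⟨ ℕ.+-monoʳ-≤ (lowerShare v ℕ.* 𝟙 (v ∈? F)) fromChildEdges ⟩
  received F v ∎
  where
  open ℕ.≤-Reasoning
  fromOwnEdge : ∑ (E F) (λ e → lowerShare e ℕ.* 𝟙 (e ≟v v)) ≡ lowerShare v ℕ.* 𝟙 (v ∈? F)
  fromOwnEdge = begin-equality
    ∑ (E F) (λ e → lowerShare e ℕ.* 𝟙 (e ≟v v)) ≡⟨ ∑-cong (E F) (λ {e} _ → *-𝟙-≟-swap lowerShare e v) ⟩
    ∑ (E F) (λ e → lowerShare v ℕ.* 𝟙 (v ≟v e)) ≡⟨ ∑-distribˡ-* (E F) (lowerShare v) (λ e → 𝟙 (v ≟v e)) ⟩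
    lowerShare v ℕ.* count v (E F)             ≡⟨ cong (lowerShare v ℕ.*_) (count-deduplicate v F) ⟩
    lowerShare v ℕ.* 𝟙 (v ∈? F)                ∎
  fromChildEdges : ∑ (E F) (λ e → 𝟙 (parent e ≟v v)) ℕ.≤ ∑ (children v) (λ c → 𝟙 (c ∈? F))
  fromChildEdges = begin
    ∑ (E F) (λ e → 𝟙 (parent e ≟v v))
      ≤⟨ ∑-mono-≤ (E F) (λ {e} _ → 𝟙-parent-≟≤count-children e v) ⟩
    ∑ (E F) (λ e → count e (children v))
      ≡⟨ ∑-comm (E F) (children v) (λ e c → 𝟙 (e ≟v c)) ⟩
    ∑ (children v) (λ c → ∑ (E F) (λ e → 𝟙 (e ≟v c)))
      ≡⟨ ∑-cong (children v) (λ {c} _ → ∑-cong (E F) (λ {e} _ → 𝟙-≟-sym e c)) ⟩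
    ∑ (children v) (λ c → count c (E F))
      ≡⟨ ∑-cong (children v) (λ {c} _ → count-deduplicate c F) ⟩
    ∑ (children v) (λ c → 𝟙 (c ∈? F)) ∎

boundary+received≤3 : ∀ F {v} → v ∈ V F → boundary F v ℕ.+ received F v ℕ.≤ 3
boundary+received≤3 F {zero , n} leaf∈V = ℕ.≤-reflexive (cong₂ ℕ._+_ notBoundary receives3)
  where
  leaf∈F = leaf∈V⇒∈F leaf∈V
  notBoundary : boundary F (zero , n) ≡ 0
  notBoundary = 𝟙-no (any? (λ e → ¬? (e ∈? F)) ((zero , n) ∷ [])) (λ missing → Any¬⇒¬All missing (leaf∈F ∷ []))
  receives3 : received F (zero , n) ≡ 3
  receives3 = cong (λ k → 3 ℕ.* k ℕ.+ 0) (𝟙-yes ((zero , n) ∈? F) leaf∈F)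
boundary+received≤3 F {v@(suc _ , _)} _ = begin
  boundary F v ℕ.+ received F v
    ≡⟨ cong (λ k → boundary F v ℕ.+ (k ℕ.+ ∑ (children v) (λ c → 𝟙 (c ∈? F)))) (ℕ.*-identityˡ (𝟙 (v ∈? F))) ⟩
  boundary F v ℕ.+ ∑ (incidentEdges v) (λ e → 𝟙 (e ∈? F))
    ≤⟨ 𝟙-any¬+∑𝟙≤length (_∈? F) (incidentEdges v) ⟩
  3 ∎
  where open ℕ.≤-Reasoning

∂+∑weight≤3∣V∣ : ∀ F → ∂ F ℕ.+ ∑ (E F) weight ℕ.≤ 3 ℕ.* length (V F)
∂+∑weight≤3∣V∣ F = begin
  ∂ F ℕ.+ ∑ (E F) weight
    ≡⟨ cong₂ ℕ._+_ (length-filter≡∑𝟙 _ (V F)) (sym weight≡∑share) ⟩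
  ∑ (V F) (boundary F) ℕ.+ ∑ (E F) (λ e → ∑ (V F) (share e))
    ≡⟨ cong (∑ (V F) (boundary F) ℕ.+_) (∑-comm (E F) (V F) share) ⟩
  ∑ (V F) (boundary F) ℕ.+ ∑ (V F) (λ v → ∑ (E F) (λ e → share e v))
    ≡⟨ ∑-distrib-+ (V F) (boundary F) _ ⟨
  ∑ (V F) (λ v → boundary F v ℕ.+ ∑ (E F) (λ e → share e v))
    ≤⟨ ∑-mono-≤ (V F) (λ {v} v∈V → ℕ.≤-trans (ℕ.+-monoʳ-≤ (boundary F v) (∑-share≤received F v))
                                               (boundary+received≤3 F v∈V)) ⟩
  ∑ (V F) (λ _ → 3)
    ≡⟨ ∑-const (V F) 3 ⟩
  3 ℕ.* length (V F) ∎
  where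
  open ℕ.≤-Reasoning
  weight≡∑share : ∑ (E F) (λ e → ∑ (V F) (share e)) ≡ ∑ (E F) weight
  weight≡∑share = ∑-cong (E F) (λ e∈E → ∑-share≡weight F (∈-deduplicate⁻ _≟v_ F e∈E))

-- mkℚᵘ takes the denominator minus one.
thirds : ℕ → ℚᵘ
thirds k = mkℚᵘ (+ k) 2

thirds-+ : ∀ m n → thirds m ℚᵘ.+ thirds n ≃ thirds (m ℕ.+ n)
thirds-+ m n = *≡* (trans (distrib (+ m) (+ n)) (cong (ℤ._* + 9) (sym (ℤ.pos-+ m n))))
  where
  distrib : ∀ a b → (a ℤ.* + 3 ℤ.+ b ℤ.* + 3) ℤ.* + 3 ≡ (a ℤ.+ b) ℤ.* + 9
  distrib = solve-∀

θ≃thirds-weight : ∀ e → ℚ.toℚᵘ (θ e) ≃ thirds (weight e)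
θ≃thirds-weight (zero  , _) = toℚᵘ-fromℚᵘ (thirds 4)
θ≃thirds-weight (suc _ , _) = toℚᵘ-fromℚᵘ (thirds 2)

sumℚ-θ≃thirds : ∀ es → ℚ.toℚᵘ (sumℚ (map θ es)) ≃ thirds (∑ es weight)
sumℚ-θ≃thirds []       = *≡* refl
sumℚ-θ≃thirds (e ∷ es) = ℚᵘ.≃-trans (toℚᵘ-homo-+ (θ e) (sumℚ (map θ es)))
  (ℚᵘ.≃-trans (ℚᵘ.+-cong (θ≃thirds-weight e) (sumℚ-θ≃thirds es)) (thirds-+ (weight e) (∑ es weight)))

Δθ≃ : ∀ F → ℚ.toℚᵘ (Δθ F) ≃ mkℚᵘ (+ length (V F)) 0 ℚᵘ.- thirds (∑ (E F) weight)
Δθ≃ F = ℚᵘ.≃-trans (toℚᵘ-homo-+ (+ length (V F) / 1) (ℚ.- sumℚ (map θ (E F))))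
  (ℚᵘ.+-cong (toℚᵘ-fromℚᵘ (mkℚᵘ (+ length (V F)) 0))
    (ℚᵘ.≃-trans (toℚᵘ-homo‿- (sumℚ (map θ (E F)))) (ℚᵘ.-‿cong (sumℚ-θ≃thirds (E F)))))

thirds-≤-sub : ∀ d w n → d ℕ.+ w ℕ.≤ 3 ℕ.* n → thirds d ℚᵘ.≤ mkℚᵘ (+ n) 0 ℚᵘ.- thirds w
thirds-≤-sub d w n d+w≤3n = *≤* (begin
  + d ℤ.* + 3                                ≡⟨ ℤ.pos-* d 3 ⟨
  + (d ℕ.* 3)                                ≤⟨ +≤+ (ℕ.*-monoˡ-≤ 3 (ℕ.m+n≤o⇒m≤o∸n d d+w≤n3)) ⟩
  + ((n ℕ.* 3 ℕ.∸ w) ℕ.* 3)                  ≡⟨ ℤ.pos-* (n ℕ.* 3 ℕ.∸ w) 3 ⟩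
  + (n ℕ.* 3 ℕ.∸ w) ℤ.* + 3                  ≡⟨ cong (ℤ._* + 3) numerator ⟨
  (+ n ℤ.* + 3 ℤ.+ ℤ.- (+ w) ℤ.* + 1) ℤ.* + 3 ∎)
  where
  open ℤ.≤-Reasoning
  d+w≤n3 : d ℕ.+ w ℕ.≤ n ℕ.* 3
  d+w≤n3 = ℕ.≤-trans d+w≤3n (ℕ.≤-reflexive (ℕ.*-comm 3 n))
  numerator : + n ℤ.* + 3 ℤ.+ ℤ.- (+ w) ℤ.* + 1 ≡ + (n ℕ.* 3 ℕ.∸ w)
  numerator = begin-equality
    + n ℤ.* + 3 ℤ.+ ℤ.- (+ w) ℤ.* + 1 ≡⟨ cong₂ ℤ._+_ (sym (ℤ.pos-* n 3)) (ℤ.*-identityʳ (ℤ.- (+ w))) ⟩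
    + (n ℕ.* 3) ℤ.+ ℤ.- (+ w)          ≡⟨ ℤ.m-n≡m⊖n (n ℕ.* 3) w ⟩
    n ℕ.* 3 ℤ.⊖ w                      ≡⟨ ℤ.⊖-≥ (ℕ.m+n≤o⇒n≤o d d+w≤n3) ⟩
    + (n ℕ.* 3 ℕ.∸ w)                  ∎

lemma3p8 : (F : Subgraph) → (+ ∂ F) / 3 ≤ Δθ F
lemma3p8 F = toℚᵘ-cancel-≤
  (ℚᵘ.≤-respˡ-≃ (ℚᵘ.≃-sym (toℚᵘ-fromℚᵘ (thirds (∂ F))))
  (ℚᵘ.≤-respʳ-≃ (ℚᵘ.≃-sym (Δθ≃ F))
  (thirds-≤-sub (∂ F) (∑ (E F) weight) (length (V F)) (∂+∑weight≤3∣V∣ F))))
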